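{- Let $n\in\mathbb{N}$. The sequence $(\mathbf{x}^i)_{i\in[2^n]}\subset\{0,1\}^n$ given by $\mathbf{x}^1:=\mathbf{0}$ and $\mathbf{x}^{i+1}:=\mathbf{x}^i+(1-2(x^i)_{k_i})\mathbf{e}^{k_i}$ for all $i\in[2^n-1]$, where $k_i\in[n]$ is the unique index such that either $\partial_{k_i}F_n(\mathbf{x}^i)>0$ and $(x^i)_{k_i}=0$, or $\partial_{k_i}F_n(\mathbf{x}^i)<0$ and $(x^i)_{k_i}=1$, forms a Hamiltonian path in the graph of the hypercube $[0,1]^n$ (vertices $\{0,1\}^n$, edges between vectors differing in exactly one coordinate) ending in $\mathbf{e}^n$.
   Context: For $n\in\mathbb{N}$ and $\mathbf{x}=(x_1,\dots,x_n)^\top\in\mathbb{R}^n$, set $x_0:=1$, $\alpha_{n,n+1}(\mathbf{x})=0$, and for $i\in[n]=\{1,\dots,n\}$: $\alpha_{n,i}(\mathbf{x})=x_i+(1-2x_i)\alpha_{n,i+1}(\mathbf{x})$ and $\beta_{n,i}(\mathbf{x})=2^i(x_i-x_i^2)\bigl(1-x_{i-1}+\sum_{j=1}^{i-2}x_j\bigr)$. Define $F_n(\mathbf{x})=\sum_{i=1}^n\bigl(2^{i-1}\alpha_{n,i}(\mathbf{x})-\beta_{n,i}(\mathbf{x})\bigr)$. For every $\mathbf{x}\in\{0,1\}^n\setminus\{\mathbf{e}^n\}$ there is exactly one $k\in[n]$ with ($\partial_kF_n(\mathbf{x})>0$ and $x_k=0$) or ($\partial_kF_n(\mathbf{x})<0$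 and $x_k=1$) (established separately in the paper). $\mathbf{e}^k$ is the $k$-th unit vector and $(x^i)_k$ the $k$-th coordinate of $\mathbf{x}^i$. -}

module Defs where

open import Data.Nat as ℕ using (ℕ; zero; suc; _∸_; _^_; _<?_)
open import Data.Integer as ℤ using (ℤ; +_; -[1+_])
open import Data.Fin as Fin using (Fin; fromℕ<)
open import Data.Bool using (Bool; true; false; not)
open import Data.Vec using (Vec; lookup; tabulate; replicate; updateAt)
open import Data.Product using (Σ; ∃; _×_)
open import Data.Sum using (_⊎_)
open import Relation.Nullary using (yes; no; ¬_; ⌊_⌋)
open import Relation.Binary.PropositionalEquality using (_≡_)

data Poly (n : ℕ) : Set where
  con : ℤ → Poly n
  var : Fin n → Poly n
  _⊕_ : Poly n → Poly n → Poly n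
  _⊗_ : Poly n → Poly n → Poly n

infixl 6 _⊕_
infixl 7 _⊗_

eval : ∀ {n} → Poly n → (Fin n → ℤ) → ℤ
eval (con c) ρ = c
eval (var i) ρ = ρ i
eval (p ⊕ q) ρ = eval p ρ ℤ.+ eval q ρ
eval (p ⊗ q) ρ = eval p ρ ℤ.* eval q ρ

∂ : ∀ {n} → Fin n → Poly n → Poly n
∂ k (con c) = con (+ 0)
∂ k (var i) with Fin._≟_ i k
... | yes _ = con (+ 1)
... | no _ = con (+ 0)
∂ k (p ⊕ q) = ∂ k p ⊕ ∂ k q
∂ k (p ⊗ q) = ∂ k p ⊗ q ⊕ p ⊗ ∂ k q

module _ (n : ℕ) where

  -- X i = x_i with the paper's 1-based indexing (x_1,…,x_n are the
  -- variables, coordinate i is Fin index i-1); X 0 = x_0 := 1.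
  X : ℕ → Poly n
  X zero = con (+ 1)
  X (suc j) with j <? n
  ... | yes p = var (fromℕ< p)
  ... | no _ = con (+ 0)

  -- αaux d = α_{n,n+1-d}; α_{n,n+1} = 0,
  -- α_{n,i} = x_i + (1 - 2 x_i) α_{n,i+1}
  αaux : ℕ → Poly n
  αaux zero = con (+ 0)
  αaux (suc d) = X (n ∸ d) ⊕ (con (+ 1) ⊕ con (ℤ.- (+ 2)) ⊗ X (n ∸ d)) ⊗ αaux d

  α : ℕ → Poly n
  α i = αaux (suc n ∸ i)

  sumX : ℕ → Poly n
  sumX zero = con (+ 0)
  sumX (suc m) = sumX m ⊕ X (suc m)

  β : ℕ → Poly n
  β i = con (+ (2 ^ i)) ⊗ (X i ⊕ con (ℤ.- (+ 1)) ⊗ (X i ⊗ X i))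
          ⊗ (con (+ 1) ⊕ con (ℤ.- (+ 1)) ⊗ X (i ∸ 1) ⊕ sumX (i ∸ 2))

  Fsum : ℕ → Poly n
  Fsum zero = con (+ 0)
  Fsum (suc m) = Fsum m ⊕ (con (+ (2 ^ m)) ⊗ α (suc m) ⊕ con (ℤ.- (+ 1)) ⊗ β (suc m))

  F : Poly n
  F = Fsum n

toℤ : ∀ {n} → Vec Bool n → Fin n → ℤ
toℤ v i with lookup v i
... | true = + 1
... | false = + 0

∂F : ∀ {n} → Fin n → Vec Bool n → ℤ
∂F {n} k x = eval (∂ k (F n)) (toℤ x)

Improving : ∀ {n} → Fin n → Vec Bool n → Set
Improving k x = (+ 0 ℤ.< ∂F k x × lookup x k ≡ false)
              ⊎ (∂F k x ℤ.< + 0 × lookup x k ≡ true)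

-- x + (1 - 2 x_k) e^k for x ∈ {0,1}^n: flip coordinate k
flipAt : ∀ {n} → Fin n → Vec Bool n → Vec Bool n
flipAt k x = updateAt x k not

unitVec : ∀ {n} → Fin n → Vec Bool n
unitVec k = tabulate (λ j → ⌊ Fin._≟_ j k ⌋)

zeroVec : ∀ {n} → Vec Bool n
zeroVec = replicate _ false

Adjacent : ∀ {n} → Vec Bool n → Vec Bool n → Set
Adjacent {n} u v = Σ (Fin n) λ k → (¬ lookup u k ≡ lookup v k)
                     × (∀ j → ¬ j ≡ k → lookup u j ≡ lookup v j)

HamiltonianPath : (n : ℕ) → (ℕ → Vec Bool n) → Set
HamiltonianPath n x =
    (∀ i j → i ℕ.< 2 ^ n → j ℕ.< 2 ^ n → x i ≡ x j → i ≡ j)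
  × (∀ v → Σ ℕ λ i → i ℕ.< 2 ^ n × x i ≡ v)
  × (∀ i → suc i ℕ.< 2 ^ n → Adjacent (x i) (x (suc i)))

Vec' : ℕ → Set
Vec' n = Vec Bool n

-- On {0,1}^n the polynomial α_{n,i} takes the value x_i xor … xor x_n, and the factor
-- x_i - x_i² of β_{n,i} vanishes. Suppose x_κ = 1 and x_1 = … = x_{κ-1} = 0 (with x_0 = 1),
-- and put e = 1 - 2 α_{n,κ+2}(x) = ±1. Then ∂_{κ+1} β_{n,i}(x) = 0 for every i (for
-- i = κ+1 because the cofactor 1 - x_κ + x_1 + … + x_{κ-1} is 0), while ∂_{κ+1} α_{n,i}(x)
-- is 0 for i > κ+1, e for i = κ+1 and -e for i ≤ κ. Hence ∂_{κ+1} F_n(x) = 2^κ e - (2^κ - 1) e = e,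
-- and κ+1 is the selected index exactly when x_{κ+1} = α_{n,κ+2}(x).
-- These are the moves of the reflected binary Gray code: if i has exactly κ trailing ones in
-- binary, the Gray code x of i satisfies the hypothesis above together with x_{κ+1} = α_{n,κ+2}(x),
-- and the Gray code of i+1 is x with coordinate κ+1 flipped. So the path lists the Gray codes
-- of 0, 1, …, 2^n - 1, which are all distinct, and the last of them is e^n.
{-# OPTIONS --safe #-}
module Submission where

open import Defs
open import Data.Nat using (ℕ; suc; _<_; _^_; _∸_)
open import Data.Fin using (fromℕ)
open import Data.Product using (Σ; _×_)
open import Relation.Binary.PropositionalEquality using (_≡_)

open import Data.Bool using (Bool; true; false; not; _xor_; if_then_else_)
open import Data.Bool.Properties using (xor-assoc; xor-same; xor-identityʳ; not-¬)
open import Data.Empty using (⊥; ⊥-elim)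
open import Data.Fin using (Fin; zero; suc; toℕ; fromℕ<; _≟_)
open import Data.Fin.Properties using (toℕ<n; fromℕ<-toℕ; toℕ-fromℕ<; suc-injective)
open import Data.Integer as ℤ using (ℤ; +_; _+_; _*_; _-_; -_)
open import Data.Integer.Properties using (*-zeroʳ; *-identityˡ; +-identityˡ; +-identityʳ; -1*i≡-i; pos-*)
open import Data.Integer.Tactic.RingSolver using (solve-∀)
open import Data.Nat as ℕ using (zero; _≤_; z≤n; s≤s)
open import Data.Nat.Properties as ℕ using ()
open import Data.Product using (_,_)
open import Data.Sum using (_⊎_; inj₁; inj₂)
open import Data.Unit using (⊤)
open import Data.Vec using (Vec; []; _∷_; lookup; replicate)
open import Data.Vec.Properties using (lookup∘updateAt; lookup∘updateAt′; tabulate-cong)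
open import Function using (_∘_)
open import Relation.Nullary using (yes; no)
open import Relation.Nullary.Decidable using (⌊⌋-map′)
open import Relation.Binary.PropositionalEquality
  using (_≢_; refl; sym; trans; cong; cong₂; subst; module ≡-Reasoning)

open ≡-Reasoning

-- Derivatives of F_n at the vertices of the cube

⟦_⟧ : Bool → ℤ
⟦ true ⟧ = + 1
⟦ false ⟧ = + 0

sign : Bool → ℤ
sign false = + 1
sign true = - + 1

z≡⟦b⟧⇒1-2z≡sign : ∀ {z b} → z ≡ ⟦ b ⟧ → + 1 - + 2 * z ≡ sign b
z≡⟦b⟧⇒1-2z≡sign {b = true} refl = refl
z≡⟦b⟧⇒1-2z≡sign {b = false} refl = refl

toℤ-lookup : ∀ {n} (x : Vec Bool n) i → toℤ x i ≡ ⟦ lookup x i ⟧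
toℤ-lookup x i with lookup x i
... | true = refl
... | false = refl

-- x_j in the paper's indexing: x_0 = 1, and x_j = 0 for j > n, as in X
coord : ∀ {n} → Vec Bool n → ℕ → Bool
coord v zero = true
coord [] (suc j) = false
coord (b ∷ v) (suc zero) = b
coord (b ∷ v) (suc (suc j)) = coord v (suc j)

coord-beyond : ∀ {n} (v : Vec Bool n) j → n ≤ j → coord v (suc j) ≡ false
coord-beyond [] j _ = refl
coord-beyond (b ∷ v) (suc j) (s≤s n≤j) = coord-beyond v j n≤j

lookup-fromℕ< : ∀ {n} (v : Vec Bool n) {j} (j<n : j < n) → lookup v (fromℕ< j<n) ≡ coord v (suc j)
lookup-fromℕ< (b ∷ v) {zero} _ = refl
lookup-fromℕ< (b ∷ v) {suc j} (s≤s j<n) = lookup-fromℕ< v j<n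

-- x_{q+1} xor … xor x_n, the value of α_{n,q+1} on the cube
parityFrom : ∀ {n} → Vec Bool n → ℕ → Bool
parityFrom [] _ = false
parityFrom (b ∷ v) zero = b xor parityFrom v zero
parityFrom (b ∷ v) (suc q) = parityFrom v q

parityFrom-unfold : ∀ {n} (v : Vec Bool n) q → parityFrom v q ≡ coord v (suc q) xor parityFrom v (suc q)
parityFrom-unfold [] q = refl
parityFrom-unfold (b ∷ v) zero = refl
parityFrom-unfold (b ∷ v) (suc q) = parityFrom-unfold v q

parityFrom-length : ∀ {n} (v : Vec Bool n) → parityFrom v n ≡ false
parityFrom-length [] = refl
parityFrom-length (b ∷ v) = parityFrom-length v

-- used with κ = toℕ k, whose coordinate is x_{κ+1}: either κ = 0, or x_κ is the first 1
-- among x_1, …, x_n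
record ClearBelow {n} (x : Vec Bool n) (κ : ℕ) : Set where
  field
    pivot : coord x κ ≡ true
    clear : ∀ p → suc p < κ → coord x (suc p) ≡ false

-- α_{n,i} = x_i ⊻ₚ α_{n,i+1}: the multilinear extension of xor
_⊻ₚ_ : ∀ {n} → Poly n → Poly n → Poly n
P ⊻ₚ Q = P ⊕ (con (+ 1) ⊕ con (- + 2) ⊗ P) ⊗ Q

eval-⊻ₚ : ∀ {n} (P Q : Poly n) ρ {a b} → eval P ρ ≡ ⟦ a ⟧ → eval Q ρ ≡ ⟦ b ⟧ →
          eval (P ⊻ₚ Q) ρ ≡ ⟦ a xor b ⟧
eval-⊻ₚ P Q ρ {a} {b} evP evQ =
  trans (cong₂ (λ p q → p + (+ 1 + - + 2 * p) * q) evP evQ) (table a b)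
  where
  table : ∀ a b → ⟦ a ⟧ + (+ 1 + - + 2 * ⟦ a ⟧) * ⟦ b ⟧ ≡ ⟦ a xor b ⟧
  table true true = refl
  table true false = refl
  table false true = refl
  table false false = refl

eval-∂-⊻ₚ : ∀ {n} k (P Q : Poly n) ρ →
            eval (∂ k (P ⊻ₚ Q)) ρ
            ≡ eval (∂ k P) ρ * (+ 1 - + 2 * eval Q ρ) + (+ 1 - + 2 * eval P ρ) * eval (∂ k Q) ρ
eval-∂-⊻ₚ k P Q ρ = expand (eval (∂ k P) ρ) (eval P ρ) (eval Q ρ) (eval (∂ k Q) ρ)
  where
  expand : ∀ dp p q dq → dp + ((+ 0 + (+ 0 * p + - + 2 * dp)) * q + (+ 1 + - + 2 * p) * dq)
                         ≡ dp * (+ 1 - + 2 * q) + (+ 1 - + 2 * p) * dq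
  expand = solve-∀

-- the shape of β_{n,i}; when P is 0 or 1 the factor P - P² vanishes and only its derivative survives
eval-∂-c*[P-P²]*Q : ∀ {n} k c (P Q : Poly n) ρ {b} → eval P ρ ≡ ⟦ b ⟧ →
              eval (∂ k (con c ⊗ (P ⊕ con (- + 1) ⊗ (P ⊗ P)) ⊗ Q)) ρ
              ≡ c * eval (∂ k P) ρ * sign b * eval Q ρ
eval-∂-c*[P-P²]*Q k c P Q ρ {b} evP = begin
    eval (∂ k (con c ⊗ (P ⊕ con (- + 1) ⊗ (P ⊗ P)) ⊗ Q)) ρ
  ≡⟨ expand c p dp q dq ⟩
    c * dp * (+ 1 - + 2 * p) * q + c * (p - p * p) * dq
  ≡⟨ cong₂ (λ s z → c * dp * s * q + c * z * dq) (z≡⟦b⟧⇒1-2z≡sign evP) (cong (λ z → z - z * z) evP) ⟩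
    c * dp * sign b * q + c * (⟦ b ⟧ - ⟦ b ⟧ * ⟦ b ⟧) * dq
  ≡⟨ cong (λ z → c * dp * sign b * q + c * z * dq) (idempotent b) ⟩
    c * dp * sign b * q + c * + 0 * dq
  ≡⟨ drop (c * dp * sign b * q) c dq ⟩
    c * dp * sign b * q ∎
  where
  p = eval P ρ
  dp = eval (∂ k P) ρ
  q = eval Q ρ
  dq = eval (∂ k Q) ρ
  expand : ∀ c p dp q dq →
           (+ 0 * (p + - + 1 * (p * p)) + c * (dp + (+ 0 * (p * p) + - + 1 * (dp * p + p * dp)))) * q
             + c * (p + - + 1 * (p * p)) * dq
           ≡ c * dp * (+ 1 - + 2 * p) * q + c * (p - p * p) * dq
  expand = solve-∀
  idempotent : ∀ b → ⟦ b ⟧ - ⟦ b ⟧ * ⟦ b ⟧ ≡ + 0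
  idempotent true = refl
  idempotent false = refl
  drop : ∀ a c d → a + c * + 0 * d ≡ a
  drop = solve-∀

βcofactor : ∀ n → ℕ → Poly n
βcofactor n i = con (+ 1) ⊕ con (- + 1) ⊗ X n (i ∸ 1) ⊕ sumX n (i ∸ 2)

-- with d + t = n, αaux n d is α_{n,t+1}; indexing by t avoids truncated subtraction
αaux-unfold : ∀ {n} d t → d ℕ.+ suc t ≡ n → αaux n (suc d) ≡ X n (suc t) ⊻ₚ αaux n d
αaux-unfold {n} d t eq =
  cong (λ j → X n j ⊻ₚ αaux n d) (trans (cong (_∸ d) (sym eq)) (ℕ.m+n∸m≡n d (suc t)))

eval-∂X-self : ∀ {n} (k : Fin n) ρ → eval (∂ k (X n (suc (toℕ k)))) ρ ≡ + 1
eval-∂X-self {n} k ρ with toℕ k ℕ.<? n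
... | no k≮n = ⊥-elim (k≮n (toℕ<n k))
... | yes k<n with fromℕ< k<n ≟ k
...   | yes _ = refl
...   | no k≢k = ⊥-elim (k≢k (fromℕ<-toℕ k k<n))

eval-∂X-other : ∀ {n} (k : Fin n) j ρ → j ≢ suc (toℕ k) → eval (∂ k (X n j)) ρ ≡ + 0
eval-∂X-other k zero ρ _ = refl
eval-∂X-other {n} k (suc j) ρ j≢k with j ℕ.<? n
... | no _ = refl
... | yes j<n with fromℕ< j<n ≟ k
...   | no _ = refl
...   | yes refl = ⊥-elim (j≢k (cong suc (sym (toℕ-fromℕ< j<n))))

eval-∂Fsum-suc : ∀ {n} (k : Fin n) ρ j → eval (∂ k (β n (suc j))) ρ ≡ + 0 →
                 eval (∂ k (Fsum n (suc j))) ρ ≡ eval (∂ k (Fsum n j)) ρ + + (2 ^ j) * eval (∂ k (α n (suc j))) ρ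
eval-∂Fsum-suc {n} k ρ j ∂β≡0 =
  trans (cong (λ db → D + ((+ 0 * a + y * da) + (+ 0 * b + - + 1 * db))) ∂β≡0) (expand D y a da b)
  where
  D = eval (∂ k (Fsum n j)) ρ
  y = + (2 ^ j)
  a = eval (α n (suc j)) ρ
  da = eval (∂ k (α n (suc j))) ρ
  b = eval (β n (suc j)) ρ
  expand : ∀ D y a da b → D + ((+ 0 * a + y * da) + (+ 0 * b + - + 1 * + 0)) ≡ D + y * da
  expand = solve-∀

module _ {n : ℕ} (x : Vec Bool n) where

  eval-X : ∀ j → eval (X n j) (toℤ x) ≡ ⟦ coord x j ⟧
  eval-X zero = refl
  eval-X (suc j) with j ℕ.<? n
  ... | yes j<n = trans (toℤ-lookup x (fromℕ< j<n)) (cong ⟦_⟧ (lookup-fromℕ< x j<n))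
  ... | no j≮n = cong ⟦_⟧ (sym (coord-beyond x j (ℕ.≮⇒≥ j≮n)))

  eval-αaux : ∀ d t → d ℕ.+ t ≡ n → eval (αaux n d) (toℤ x) ≡ ⟦ parityFrom x t ⟧
  eval-αaux zero t refl = cong ⟦_⟧ (sym (parityFrom-length x))
  eval-αaux (suc d) t eq = begin
      eval (αaux n (suc d)) (toℤ x)
    ≡⟨ cong (λ P → eval P (toℤ x)) (αaux-unfold d t eq′) ⟩
      eval (X n (suc t) ⊻ₚ αaux n d) (toℤ x)
    ≡⟨ eval-⊻ₚ (X n (suc t)) (αaux n d) (toℤ x) (eval-X (suc t)) (eval-αaux d (suc t) eq′) ⟩
      ⟦ coord x (suc t) xor parityFrom x (suc t) ⟧
    ≡⟨ cong ⟦_⟧ (sym (parityFrom-unfold x t)) ⟩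
      ⟦ parityFrom x t ⟧ ∎
    where
    eq′ = trans (ℕ.+-suc d t) eq

  eval-sumX-clear : ∀ j → (∀ p → p < j → coord x (suc p) ≡ false) → eval (sumX n j) (toℤ x) ≡ + 0
  eval-sumX-clear zero _ = refl
  eval-sumX-clear (suc j) clear =
    cong₂ _+_ (eval-sumX-clear j (λ p p<j → clear p (ℕ.m≤n⇒m≤1+n p<j)))
              (trans (eval-X (suc j)) (cong ⟦_⟧ (clear j ℕ.≤-refl)))

  eval-βcofactor-pivot : ∀ κ → ClearBelow x κ → eval (βcofactor n (suc κ)) (toℤ x) ≡ + 0
  eval-βcofactor-pivot zero _ = refl
  eval-βcofactor-pivot (suc κ) cb =
    cong₂ (λ a s → + 1 + - + 1 * a + s)
          (trans (eval-X (suc κ)) (cong ⟦_⟧ (ClearBelow.pivot cb)))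
          (eval-sumX-clear κ (λ p p<κ → ClearBelow.clear cb p (s≤s p<κ)))

module _ {n : ℕ} (x : Vec Bool n) (k : Fin n) where

  private
    κ = toℕ k
    ρ = toℤ x
    e = sign (parityFrom x (suc κ))

  eval-∂αaux-suc : ∀ d t → d ℕ.+ suc t ≡ n →
                   eval (∂ k (αaux n (suc d))) ρ
                   ≡ eval (∂ k (X n (suc t))) ρ * sign (parityFrom x (suc t))
                     + sign (coord x (suc t)) * eval (∂ k (αaux n d)) ρ
  eval-∂αaux-suc d t eq = begin
      eval (∂ k (αaux n (suc d))) ρ
    ≡⟨ cong (λ P → eval (∂ k P) ρ) (αaux-unfold d t eq) ⟩
      eval (∂ k (X n (suc t) ⊻ₚ αaux n d)) ρ
    ≡⟨ eval-∂-⊻ₚ k (X n (suc t)) (αaux n d) ρ ⟩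
      dX * (+ 1 - + 2 * eval (αaux n d) ρ) + (+ 1 - + 2 * eval (X n (suc t)) ρ) * dα
    ≡⟨ cong₂ (λ s s′ → dX * s + s′ * dα)
             (z≡⟦b⟧⇒1-2z≡sign (eval-αaux x d (suc t) eq)) (z≡⟦b⟧⇒1-2z≡sign (eval-X x (suc t))) ⟩
      dX * sign (parityFrom x (suc t)) + sign (coord x (suc t)) * dα ∎
    where
    dX = eval (∂ k (X n (suc t))) ρ
    dα = eval (∂ k (αaux n d)) ρ

  eval-∂αaux-beyond : ∀ d t → d ℕ.+ t ≡ n → κ < t → eval (∂ k (αaux n d)) ρ ≡ + 0
  eval-∂αaux-beyond zero t _ _ = refl
  eval-∂αaux-beyond (suc d) t eq κ<t = begin
      eval (∂ k (αaux n (suc d))) ρ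
    ≡⟨ eval-∂αaux-suc d t eq′ ⟩
      eval (∂ k (X n (suc t))) ρ * s + s′ * eval (∂ k (αaux n d)) ρ
    ≡⟨ cong₂ (λ a b → a * s + s′ * b)
             (eval-∂X-other k (suc t) ρ (ℕ.>⇒≢ (s≤s κ<t)))
             (eval-∂αaux-beyond d (suc t) eq′ (ℕ.m≤n⇒m≤1+n κ<t)) ⟩
      + 0 * s + s′ * + 0
    ≡⟨ trans (+-identityˡ _) (*-zeroʳ s′) ⟩
      + 0 ∎
    where
    eq′ = trans (ℕ.+-suc d t) eq
    s = sign (parityFrom x (suc t))
    s′ = sign (coord x (suc t))

  eval-∂αaux-pivot : ∀ d → d ℕ.+ κ ≡ n → eval (∂ k (αaux n d)) ρ ≡ e
  eval-∂αaux-pivot zero eq = ⊥-elim (ℕ.<⇒≢ (toℕ<n k) eq)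
  eval-∂αaux-pivot (suc d) eq = begin
      eval (∂ k (αaux n (suc d))) ρ
    ≡⟨ eval-∂αaux-suc d κ eq′ ⟩
      eval (∂ k (X n (suc κ))) ρ * e + s′ * eval (∂ k (αaux n d)) ρ
    ≡⟨ cong₂ (λ a b → a * e + s′ * b) (eval-∂X-self k ρ) (eval-∂αaux-beyond d (suc κ) eq′ ℕ.≤-refl) ⟩
      + 1 * e + s′ * + 0
    ≡⟨ simplify e s′ ⟩
      e ∎
    where
    eq′ = trans (ℕ.+-suc d κ) eq
    s′ = sign (coord x (suc κ))
    simplify : ∀ e s → + 1 * e + s * + 0 ≡ e
    simplify = solve-∀

  module _ (cb : ClearBelow x κ) where

    eval-∂αaux-below : ∀ d t → d ℕ.+ t ≡ n → t < κ → eval (∂ k (αaux n d)) ρ ≡ - e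
    eval-∂αaux-below zero t eq t<κ = ⊥-elim (ℕ.<-asym t<κ (subst (κ <_) (sym eq) (toℕ<n k)))
    eval-∂αaux-below (suc d) t eq t<κ = begin
        eval (∂ k (αaux n (suc d))) ρ
      ≡⟨ eval-∂αaux-suc d t eq′ ⟩
        eval (∂ k (X n (suc t))) ρ * s + sign (coord x (suc t)) * eval (∂ k (αaux n d)) ρ
      ≡⟨ cong (λ a → a * s + sign (coord x (suc t)) * eval (∂ k (αaux n d)) ρ)
              (eval-∂X-other k (suc t) ρ (ℕ.<⇒≢ (s≤s t<κ))) ⟩
        + 0 * s + sign (coord x (suc t)) * eval (∂ k (αaux n d)) ρ
      ≡⟨ trans (+-identityˡ _) (next (ℕ.m≤n⇒m<n∨m≡n t<κ)) ⟩
        - e ∎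
      where
      eq′ = trans (ℕ.+-suc d t) eq
      s = sign (parityFrom x (suc t))
      next : suc t < κ ⊎ suc t ≡ κ → sign (coord x (suc t)) * eval (∂ k (αaux n d)) ρ ≡ - e
      next (inj₁ t+1<κ) = begin
          sign (coord x (suc t)) * eval (∂ k (αaux n d)) ρ
        ≡⟨ cong₂ _*_ (cong sign (ClearBelow.clear cb t t+1<κ)) (eval-∂αaux-below d (suc t) eq′ t+1<κ) ⟩
          + 1 * - e
        ≡⟨ *-identityˡ (- e) ⟩
          - e ∎
      next (inj₂ t+1≡κ) = begin
          sign (coord x (suc t)) * eval (∂ k (αaux n d)) ρ
        ≡⟨ cong₂ _*_ (cong sign (subst (λ j → coord x j ≡ true) (sym t+1≡κ) (ClearBelow.pivot cb)))
                     (eval-∂αaux-pivot d (subst (λ j → d ℕ.+ j ≡ n) t+1≡κ eq′)) ⟩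
          - + 1 * e
        ≡⟨ -1*i≡-i e ⟩
          - e ∎

    eval-∂β≡0 : ∀ i → eval (∂ k (β n i)) ρ ≡ + 0
    eval-∂β≡0 i with i ℕ.≟ suc κ
    ... | yes refl = begin
        eval (∂ k (β n (suc κ))) ρ
      ≡⟨ eval-∂-c*[P-P²]*Q k c (X n (suc κ)) (βcofactor n (suc κ)) ρ (eval-X x (suc κ)) ⟩
        c * eval (∂ k (X n (suc κ))) ρ * sign (coord x (suc κ)) * eval (βcofactor n (suc κ)) ρ
      ≡⟨ cong (c * eval (∂ k (X n (suc κ))) ρ * sign (coord x (suc κ)) *_) (eval-βcofactor-pivot x κ cb) ⟩
        c * eval (∂ k (X n (suc κ))) ρ * sign (coord x (suc κ)) * + 0
      ≡⟨ *-zeroʳ (c * eval (∂ k (X n (suc κ))) ρ * sign (coord x (suc κ))) ⟩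
        + 0 ∎
      where c = + (2 ^ suc κ)
    ... | no i≢κ+1 = begin
        eval (∂ k (β n i)) ρ
      ≡⟨ eval-∂-c*[P-P²]*Q k c (X n i) (βcofactor n i) ρ (eval-X x i) ⟩
        c * eval (∂ k (X n i)) ρ * sign (coord x i) * eval (βcofactor n i) ρ
      ≡⟨ cong (λ a → c * a * sign (coord x i) * eval (βcofactor n i) ρ) (eval-∂X-other k i ρ i≢κ+1) ⟩
        c * + 0 * sign (coord x i) * eval (βcofactor n i) ρ
      ≡⟨ cong (λ a → a * sign (coord x i) * eval (βcofactor n i) ρ) (*-zeroʳ c) ⟩
        + 0 ∎
      where c = + (2 ^ i)

    eval-∂Fsum-upto-pivot : ∀ j → j ≤ κ → eval (∂ k (Fsum n j)) ρ ≡ e * (+ 1 - + (2 ^ j))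
    eval-∂Fsum-upto-pivot zero _ = sym (*-zeroʳ e)
    eval-∂Fsum-upto-pivot (suc j) j<κ = begin
        eval (∂ k (Fsum n (suc j))) ρ
      ≡⟨ eval-∂Fsum-suc k ρ j (eval-∂β≡0 (suc j)) ⟩
        eval (∂ k (Fsum n j)) ρ + y * eval (∂ k (αaux n (n ∸ j))) ρ
      ≡⟨ cong₂ (λ a b → a + y * b)
               (eval-∂Fsum-upto-pivot j (ℕ.<⇒≤ j<κ)) (eval-∂αaux-below (n ∸ j) j (ℕ.m∸n+n≡m j≤n) j<κ) ⟩
        e * (+ 1 - y) + y * - e
      ≡⟨ collect e y ⟩
        e * (+ 1 - + 2 * y)
      ≡⟨ cong (λ z → e * (+ 1 - z)) (pos-* 2 (2 ^ j)) ⟨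
        e * (+ 1 - + (2 ^ suc j)) ∎
      where
      y = + (2 ^ j)
      j≤n = ℕ.<⇒≤ (ℕ.<-trans j<κ (toℕ<n k))
      collect : ∀ e y → e * (+ 1 - y) + y * - e ≡ e * (+ 1 - + 2 * y)
      collect = solve-∀

    eval-∂Fsum-beyond-pivot : ∀ j → κ < j → j ≤ n → eval (∂ k (Fsum n j)) ρ ≡ e
    eval-∂Fsum-beyond-pivot (suc j) (s≤s κ≤j) j<n with ℕ.m≤n⇒m<n∨m≡n κ≤j
    ... | inj₂ refl = begin
        eval (∂ k (Fsum n (suc κ))) ρ
      ≡⟨ eval-∂Fsum-suc k ρ κ (eval-∂β≡0 (suc κ)) ⟩
        eval (∂ k (Fsum n κ)) ρ + y * eval (∂ k (αaux n (n ∸ κ))) ρ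
      ≡⟨ cong₂ (λ a b → a + y * b)
               (eval-∂Fsum-upto-pivot κ ℕ.≤-refl) (eval-∂αaux-pivot (n ∸ κ) (ℕ.m∸n+n≡m (ℕ.<⇒≤ j<n))) ⟩
        e * (+ 1 - y) + y * e
      ≡⟨ cancel e y ⟩
        e ∎
      where
      y = + (2 ^ κ)
      cancel : ∀ e y → e * (+ 1 - y) + y * e ≡ e
      cancel = solve-∀
    ... | inj₁ κ<j = begin
        eval (∂ k (Fsum n (suc j))) ρ
      ≡⟨ eval-∂Fsum-suc k ρ j (eval-∂β≡0 (suc j)) ⟩
        eval (∂ k (Fsum n j)) ρ + y * eval (∂ k (αaux n (n ∸ j))) ρ
      ≡⟨ cong₂ (λ a b → a + y * b)
               (eval-∂Fsum-beyond-pivot j κ<j (ℕ.<⇒≤ j<n))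
               (eval-∂αaux-beyond (n ∸ j) j (ℕ.m∸n+n≡m (ℕ.<⇒≤ j<n)) κ<j) ⟩
        e + y * + 0
      ≡⟨ cong (λ z → e + z) (*-zeroʳ y) ⟩
        e + + 0
      ≡⟨ +-identityʳ e ⟩
        e ∎
      where
      y = + (2 ^ j)

    clearBelow⇒∂F≡sign : ∂F k x ≡ e
    clearBelow⇒∂F≡sign = eval-∂Fsum-beyond-pivot n (toℕ<n k) ℕ.≤-refl

clearBelow⇒improving : ∀ {n} (x : Vec Bool n) k → ClearBelow x (toℕ k) →
                       lookup x k ≡ parityFrom x (suc (toℕ k)) → Improving k x
clearBelow⇒improving x k cb xₖ≡parity = by-sign (clearBelow⇒∂F≡sign x k cb) xₖ≡parity
  where
  by-sign : ∀ {d a l} → d ≡ sign a → l ≡ a → (+ 0 ℤ.< d × l ≡ false) ⊎ (d ℤ.< + 0 × l ≡ true)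
  by-sign {a = false} refl l≡a = inj₁ (ℤ.+<+ (s≤s z≤n) , l≡a)
  by-sign {a = true} refl l≡a = inj₂ (ℤ.-<+ , l≡a)

-- The reflected binary Gray code

-- binary numerals are little-endian; bit j of the reflected Gray code is b_j xor b_{j+1}
toGray : ∀ {n} → Vec Bool n → Vec Bool n
toGray [] = []
toGray (b ∷ v) = (b xor coord v 1) ∷ toGray v

fromGray : ∀ {n} → Vec Bool n → Vec Bool n
fromGray [] = []
fromGray (g ∷ v) = (g xor coord (fromGray v) 1) ∷ fromGray v

xor-cancelʳ : ∀ a b → (a xor b) xor b ≡ a
xor-cancelʳ a b = trans (xor-assoc a b b) (trans (cong (a xor_) (xor-same b)) (xor-identityʳ a))

fromGray-toGray : ∀ {n} (v : Vec Bool n) → fromGray (toGray v) ≡ v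
fromGray-toGray [] = refl
fromGray-toGray (b ∷ v) rewrite fromGray-toGray v = cong (_∷ v) (xor-cancelʳ b (coord v 1))

toGray-fromGray : ∀ {n} (v : Vec Bool n) → toGray (fromGray v) ≡ v
toGray-fromGray [] = refl
toGray-fromGray (g ∷ v) rewrite toGray-fromGray v = cong (_∷ v) (xor-cancelʳ g (coord (fromGray v) 1))

parityFrom-toGray : ∀ {n} (v : Vec Bool n) → parityFrom (toGray v) 0 ≡ coord v 1
parityFrom-toGray [] = refl
parityFrom-toGray (b ∷ v) rewrite parityFrom-toGray v = xor-cancelʳ b (coord v 1)

toGray-zeros : ∀ n → toGray (replicate n false) ≡ replicate n false
toGray-zeros zero = refl
toGray-zeros (suc zero) = refl
toGray-zeros (suc (suc n)) = cong (false ∷_) (toGray-zeros (suc n))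

toGray-ones : ∀ m → toGray (replicate (suc m) true) ≡ unitVec (fromℕ m)
toGray-ones zero = refl
toGray-ones (suc m) =
  cong (false ∷_) (trans (toGray-ones m) (tabulate-cong (λ j → sym (⌊⌋-map′ (cong suc) suc-injective (j ≟ fromℕ m)))))

inc : ∀ {n} → Vec Bool n → Vec Bool n
inc [] = []
inc (false ∷ v) = true ∷ v
inc (true ∷ v) = false ∷ inc v

NotFull : ∀ {n} → Vec Bool n → Set
NotFull [] = ⊥
NotFull (false ∷ v) = ⊤
NotFull (true ∷ v) = NotFull v

lowestZero : ∀ {n} (v : Vec Bool n) → NotFull v → Fin n
lowestZero (false ∷ v) _ = zero
lowestZero (true ∷ v) nf = suc (lowestZero v nf)

coord-inc : ∀ {n} (v : Vec Bool n) → NotFull v → coord (inc v) 1 ≡ not (coord v 1)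
coord-inc (false ∷ v) _ = refl
coord-inc (true ∷ v) _ = refl

toGray-inc : ∀ {n} (v : Vec Bool n) nf → toGray (inc v) ≡ flipAt (lowestZero v nf) (toGray v)
toGray-inc (false ∷ v) _ = refl
toGray-inc (true ∷ v) nf = cong₂ _∷_ (coord-inc v nf) (toGray-inc v nf)

clearBelow-∷false : ∀ {n} {g : Vec Bool n} {κ} → ClearBelow g (suc κ) → ClearBelow (false ∷ g) (suc (suc κ))
clearBelow-∷false cb = record
  { pivot = ClearBelow.pivot cb
  ; clear = λ { zero _ → refl ; (suc p) (s≤s p+1<κ+1) → ClearBelow.clear cb p p+1<κ+1 }
  }

clearBelow-lowestZero : ∀ {n} (v : Vec Bool n) nf → ClearBelow (toGray v) (toℕ (lowestZero v nf))
clearBelow-lowestZero (false ∷ v) _ = record { pivot = refl ; clear = λ _ () }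
clearBelow-lowestZero (true ∷ false ∷ v) _ = record { pivot = refl ; clear = λ { _ (s≤s ()) } }
clearBelow-lowestZero (true ∷ true ∷ v) nf = clearBelow-∷false (clearBelow-lowestZero (true ∷ v) nf)

lookup-lowestZero : ∀ {n} (v : Vec Bool n) nf →
                    lookup (toGray v) (lowestZero v nf) ≡ parityFrom (toGray v) (suc (toℕ (lowestZero v nf)))
lookup-lowestZero (false ∷ v) _ = sym (parityFrom-toGray v)
lookup-lowestZero (true ∷ v) nf = lookup-lowestZero v nf

-- Binary counting

binary : (n : ℕ) → ℕ → Vec Bool n
binary n zero = replicate n false
binary n (suc i) = inc (binary n i)

value : ∀ {n} → Vec Bool n → ℕ
value [] = 0
value (b ∷ v) = (if b then 1 else 0) ℕ.+ 2 ℕ.* value v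

value-inc : ∀ {n} (v : Vec Bool n) → NotFull v → value (inc v) ≡ suc (value v)
value-inc (false ∷ v) _ = refl
value-inc (true ∷ v) nf = trans (cong (2 ℕ.*_) (value-inc v nf)) (ℕ.*-suc 2 (value v))

value<2^n : ∀ {n} (v : Vec Bool n) → value v < 2 ^ n
value<2^n [] = s≤s z≤n
value<2^n {suc n} (b ∷ v) =
  ℕ.≤-trans (s≤s (ℕ.+-monoˡ-≤ (2 ℕ.* value v) (bit≤1 b)))
            (subst (_≤ 2 ℕ.* 2 ^ n) (ℕ.*-suc 2 (value v)) (ℕ.*-monoʳ-≤ 2 (value<2^n v)))
  where
  bit≤1 : ∀ b → (if b then 1 else 0) ≤ 1
  bit≤1 true = ℕ.≤-refl
  bit≤1 false = z≤n

suc-value<2^n⇒NotFull : ∀ {n} (v : Vec Bool n) → suc (value v) < 2 ^ n → NotFull v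
suc-value<2^n⇒NotFull [] (s≤s ())
suc-value<2^n⇒NotFull (false ∷ v) _ = _
suc-value<2^n⇒NotFull {suc n} (true ∷ v) h =
  suc-value<2^n⇒NotFull v (ℕ.*-cancelˡ-< 2 (suc (value v)) (2 ^ n) (subst (_< 2 ℕ.* 2 ^ n) (sym (ℕ.*-suc 2 (value v))) h))

value-zeros : ∀ n → value (replicate n false) ≡ 0
value-zeros zero = refl
value-zeros (suc n) = cong (2 ℕ.*_) (value-zeros n)

value-ones : ∀ n → suc (value (replicate n true)) ≡ 2 ^ n
value-ones zero = refl
value-ones (suc n) = trans (sym (ℕ.*-suc 2 (value (replicate n true)))) (cong (2 ℕ.*_) (value-ones n))

value-binary : ∀ n i → i < 2 ^ n → value (binary n i) ≡ i
value-binary n zero _ = value-zeros n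
value-binary n (suc i) i+1<2^n = trans (value-inc (binary n i) nf) (cong suc IH)
  where
  IH = value-binary n i (ℕ.<⇒≤ i+1<2^n)
  nf = suc-value<2^n⇒NotFull (binary n i) (subst (λ a → suc a < 2 ^ n) (sym IH) i+1<2^n)

binary-double : ∀ n j → binary (suc n) (2 ℕ.* j) ≡ false ∷ binary n j
binary-double n zero = refl
binary-double n (suc j) = trans (cong (binary (suc n)) (ℕ.*-suc 2 j)) (cong (inc ∘ inc) (binary-double n j))

binary-value : ∀ {n} (v : Vec Bool n) → binary n (value v) ≡ v
binary-value [] = refl
binary-value {suc n} (false ∷ v) = trans (binary-double n (value v)) (cong (false ∷_) (binary-value v))
binary-value {suc n} (true ∷ v) = trans (cong inc (binary-double n (value v))) (cong (true ∷_) (binary-value v))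

-- The Hamiltonian path

flipAt-adjacent : ∀ {n} (v : Vec Bool n) k → Adjacent v (flipAt k v)
flipAt-adjacent v k =
  k , (λ vₖ≡vₖ′ → not-¬ refl (trans vₖ≡vₖ′ (lookup∘updateAt k v)))
    , (λ j j≢k → sym (lookup∘updateAt′ j k j≢k v))

graySequence : (n : ℕ) → ℕ → Vec Bool n
graySequence n i = toGray (binary n i)

graySequence-step : ∀ n i → suc i < 2 ^ n →
                    Σ (Fin n) λ k → Improving k (graySequence n i)
                                  × (graySequence n (suc i) ≡ flipAt k (graySequence n i))
graySequence-step n i i+1<2^n =
  lowestZero v nf , clearBelow⇒improving (toGray v) (lowestZero v nf) (clearBelow-lowestZero v nf) (lookup-lowestZero v nf)
                  , toGray-inc v nf
  where
  v = binary n i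
  nf = suc-value<2^n⇒NotFull v (subst (λ a → suc a < 2 ^ n) (sym (value-binary n i (ℕ.<⇒≤ i+1<2^n))) i+1<2^n)

graySequence-adjacent : ∀ n i → suc i < 2 ^ n → Adjacent (graySequence n i) (graySequence n (suc i))
graySequence-adjacent n i i+1<2^n with graySequence-step n i i+1<2^n
... | k , _ , step = subst (Adjacent (graySequence n i)) (sym step) (flipAt-adjacent (graySequence n i) k)

graySequence-injective : ∀ n i j → i < 2 ^ n → j < 2 ^ n → graySequence n i ≡ graySequence n j → i ≡ j
graySequence-injective n i j i<2^n j<2^n gᵢ≡gⱼ = begin
    i                                     ≡⟨ value-binary n i i<2^n ⟨
    value (binary n i)                    ≡⟨ cong value (fromGray-toGray (binary n i)) ⟨
    value (fromGray (graySequence n i))   ≡⟨ cong (value ∘ fromGray) gᵢ≡gⱼ ⟩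
    value (fromGray (graySequence n j))   ≡⟨ cong value (fromGray-toGray (binary n j)) ⟩
    value (binary n j)                    ≡⟨ value-binary n j j<2^n ⟩
    j                                     ∎

graySequence-surjective : ∀ n (v : Vec Bool n) → Σ ℕ λ i → i < 2 ^ n × graySequence n i ≡ v
graySequence-surjective n v =
  value (fromGray v) , value<2^n (fromGray v) , trans (cong toGray (binary-value (fromGray v))) (toGray-fromGray v)

graySequence-last : ∀ m → graySequence (suc m) (2 ^ suc m ∸ 1) ≡ unitVec (fromℕ m)
graySequence-last m = begin
    toGray (binary (suc m) (2 ^ suc m ∸ 1))                       ≡⟨ cong (λ i → toGray (binary (suc m) (i ∸ 1))) (value-ones (suc m)) ⟨
    toGray (binary (suc m) (value (replicate (suc m) true)))     ≡⟨ cong toGray (binary-value (replicate (suc m) true)) ⟩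
    toGray (replicate (suc m) true)                              ≡⟨ toGray-ones m ⟩
    unitVec (fromℕ m)                                            ∎

proposition4 : (m : ℕ) → Σ (ℕ → Vec' (suc m)) λ x →
      (x 0 ≡ zeroVec)
    × (∀ i → suc i < 2 ^ suc m →
          Σ _ λ k → Improving k (x i) × (x (suc i) ≡ flipAt k (x i)))
    × HamiltonianPath (suc m) x
    × (x (2 ^ suc m ∸ 1) ≡ unitVec (fromℕ m))
proposition4 m =
    graySequence n
  , toGray-zeros n
  , graySequence-step n
  , ( graySequence-injective n
    , graySequence-surjective n
    , graySequence-adjacent n )
  , graySequence-last m
  where
  n = suc m
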